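{- For every $n\in\mathbb{N}$, \[ \sum_{k=1}^{n}\frac{(-1)^{k}H_k}{k\binom{n}{k}}=\frac{(-1)^{n}H_{n+1}}{n+1}+\sum_{k=1}^{n+1}\frac{(-1)^{k}}{k^2\binom{n+1}{k}}. \]
   Context: $H_j=\sum_{i=1}^j\frac1i$. -}

module Defs where

open import Data.Nat using (ℕ; zero; suc) renaming (_*_ to _*ℕ_)
open import Data.Nat.Combinatorics using (_C_)
open import Data.Integer using (+_; -[1+_])
open import Data.Rational using (ℚ; 0ℚ; 1ℚ; _/_; _+_; _*_; -_)

-- reciprocal of a natural number as a rational; inv 0 = 0 by convention
-- (only ever applied to nonzero arguments below)
inv : ℕ → ℚ
inv zero    = 0ℚ
inv (suc m) = + 1 / suc m

ι : ℕ → ℚ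
ι m = + m / 1

sgn : ℕ → ℚ
sgn zero    = 1ℚ
sgn (suc k) = - sgn k

Σ₁ : ℕ → (ℕ → ℚ) → ℚ
Σ₁ zero    f = 0ℚ
Σ₁ (suc n) f = Σ₁ n f + f (suc n)

H : ℕ → ℚ
H j = Σ₁ j inv

-- With c k = 1/((n+1) C(n,k)), the absorption identity (k+1) C(n+1,k+1) = (n+1) C(n,k) and
-- Pascal's rule give the partial fractions 1/((k+1) C(n,k+1)) = c k + c (k+1) and
-- 1/((k+1)² C(n+1,k+1)) = c k / (k+1). Summing the left-hand side by parts against
-- H (k+1) = H k + 1/(k+1) then telescopes: the first sum up to m equals the second sum up to m
-- plus the boundary term (-1)^m H m c m. At m = n that term is (-1)^n H n /(n+1), which splits into
-- (-1)^n H (n+1) /(n+1) and the k = n+1 term of the second sum.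
module Submission where

open import Defs
open import Data.Nat using (ℕ; suc) renaming (_*_ to _*ℕ_)
open import Data.Nat.Combinatorics using (_C_)
open import Data.Rational using (ℚ; _+_; _*_)
open import Relation.Binary.PropositionalEquality using (_≡_)

open import Data.Nat as ℕ using (zero; NonZero; _≤_; _<_; z≤n; s≤s)
import Data.Nat.Properties as ℕ
open import Data.Nat.Combinatorics
  using (nCk+nC[k+1]≡[n+1]C[k+1]; nCn≡1; nC1≡n)
import Data.Nat.Solver as ℕ-Solver
open import Data.Integer as ℤ using (+_)
import Data.Integer.Properties as ℤ
open import Data.Rational using (0ℚ; 1ℚ; -_; fromℚᵘ)
open import Data.Rational.Properties
  using (toℚᵘ-injective; toℚᵘ-fromℚᵘ; toℚᵘ-homo-+; toℚᵘ-homo-*; fromℚᵘ-cong; *-zeroˡ; *-zeroʳ; *-identityˡ; *-identityʳ; +-identityˡ)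
open import Data.Rational.Unnormalised as ℚᵘ using (mkℚᵘ; *≡*)
import Data.Rational.Unnormalised.Properties as ℚᵘ
open import Data.Rational.Solver using (module +-*-Solver)
open import Relation.Binary.PropositionalEquality
  using (refl; sym; trans; cong; cong₂; subst; module ≡-Reasoning)

open ≡-Reasoning

nCk>0 : ∀ {n k} → k ≤ n → 0 < n C k
nCk>0 {n}     {zero}  _         = s≤s z≤n
nCk>0 {suc n} {suc k} (s≤s k≤n) = subst (0 <_) (nCk+nC[k+1]≡[n+1]C[k+1] n k)
  (ℕ.<-≤-trans (nCk>0 k≤n) (ℕ.m≤m+n (n C k) (n C suc k)))

nCk≢0 : ∀ {n k} → k ≤ n → NonZero (n C k)
nCk≢0 k≤n = ℕ.>-nonZero (nCk>0 k≤n)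

[k+1]*[n+1]C[k+1]≡[n+1]*nCk : ∀ n k → suc k *ℕ (suc n C suc k) ≡ suc n *ℕ (n C k)
[k+1]*[n+1]C[k+1]≡[n+1]*nCk n       zero    =
  trans (ℕ.*-identityˡ (suc n C 1)) (trans (nC1≡n (suc n)) (sym (ℕ.*-identityʳ (suc n))))
[k+1]*[n+1]C[k+1]≡[n+1]*nCk zero    (suc k) = ℕ.*-zeroʳ (suc (suc k))
[k+1]*[n+1]C[k+1]≡[n+1]*nCk (suc n) (suc k) = begin
  suc (suc k) *ℕ (suc (suc n) C suc (suc k))
    ≡⟨ cong (suc (suc k) *ℕ_) (sym (nCk+nC[k+1]≡[n+1]C[k+1] (suc n) (suc k))) ⟩
  suc (suc k) *ℕ (c₁ ℕ.+ c₂)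
    ≡⟨ solve 3 (λ k c₁ c₂ → (con 2 :+ k) :* (c₁ :+ c₂) := c₁ :+ ((con 1 :+ k) :* c₁ :+ (con 2 :+ k) :* c₂))
         refl k c₁ c₂ ⟩
  c₁ ℕ.+ (suc k *ℕ c₁ ℕ.+ suc (suc k) *ℕ c₂)
    ≡⟨ cong (c₁ ℕ.+_) (cong₂ ℕ._+_ ([k+1]*[n+1]C[k+1]≡[n+1]*nCk n k) ([k+1]*[n+1]C[k+1]≡[n+1]*nCk n (suc k))) ⟩
  c₁ ℕ.+ (suc n *ℕ (n C k) ℕ.+ suc n *ℕ (n C suc k))
    ≡⟨ cong (c₁ ℕ.+_) (sym (ℕ.*-distribˡ-+ (suc n) (n C k) (n C suc k))) ⟩
  c₁ ℕ.+ suc n *ℕ (n C k ℕ.+ n C suc k)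
    ≡⟨ cong (λ c → c₁ ℕ.+ suc n *ℕ c) (nCk+nC[k+1]≡[n+1]C[k+1] n k) ⟩
  suc (suc n) *ℕ c₁ ∎
  where
  open ℕ-Solver.+-*-Solver using (solve; _:+_; _:*_; _:=_; con)
  c₁ c₂ : ℕ
  c₁ = suc n C suc k
  c₂ = suc n C suc (suc k)

[k+1]nC[k+1]*[[n+1]nCk+[n+1]nC[k+1]]≡[n+1]nCk*[n+1]nC[k+1] : ∀ n k →
  suc k *ℕ (n C suc k) *ℕ (suc n *ℕ (n C k) ℕ.+ suc n *ℕ (n C suc k))
    ≡ suc n *ℕ (n C k) *ℕ (suc n *ℕ (n C suc k))
[k+1]nC[k+1]*[[n+1]nCk+[n+1]nC[k+1]]≡[n+1]nCk*[n+1]nC[k+1] n k = begin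
  suc k *ℕ (n C suc k) *ℕ (suc n *ℕ (n C k) ℕ.+ suc n *ℕ (n C suc k))
    ≡⟨ cong (suc k *ℕ (n C suc k) *ℕ_) (trans (sym (ℕ.*-distribˡ-+ (suc n) (n C k) (n C suc k)))
                                              (cong (suc n *ℕ_) (nCk+nC[k+1]≡[n+1]C[k+1] n k))) ⟩
  suc k *ℕ (n C suc k) *ℕ (suc n *ℕ (suc n C suc k))
    ≡⟨ solve 4 (λ k b n c → (con 1 :+ k) :* b :* ((con 1 :+ n) :* c) := (con 1 :+ n) :* b :* ((con 1 :+ k) :* c))
         refl k (n C suc k) n (suc n C suc k) ⟩
  suc n *ℕ (n C suc k) *ℕ (suc k *ℕ (suc n C suc k))
    ≡⟨ cong (suc n *ℕ (n C suc k) *ℕ_) ([k+1]*[n+1]C[k+1]≡[n+1]*nCk n k) ⟩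
  suc n *ℕ (n C suc k) *ℕ (suc n *ℕ (n C k))
    ≡⟨ ℕ.*-comm (suc n *ℕ (n C suc k)) (suc n *ℕ (n C k)) ⟩
  suc n *ℕ (n C k) *ℕ (suc n *ℕ (n C suc k)) ∎
  where open ℕ-Solver.+-*-Solver using (solve; _:+_; _:*_; _:=_; con)

open +-*-Solver using (solve; _:+_; _:*_; :-_; _:=_)

fromℚᵘ-homo-+ : ∀ p q → fromℚᵘ (p ℚᵘ.+ q) ≡ fromℚᵘ p + fromℚᵘ q
fromℚᵘ-homo-+ p q = toℚᵘ-injective (ℚᵘ.≃-trans (toℚᵘ-fromℚᵘ (p ℚᵘ.+ q))
  (ℚᵘ.≃-trans (ℚᵘ.+-cong (ℚᵘ.≃-sym (toℚᵘ-fromℚᵘ p)) (ℚᵘ.≃-sym (toℚᵘ-fromℚᵘ q)))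
    (ℚᵘ.≃-sym (toℚᵘ-homo-+ (fromℚᵘ p) (fromℚᵘ q)))))

fromℚᵘ-homo-* : ∀ p q → fromℚᵘ (p ℚᵘ.* q) ≡ fromℚᵘ p * fromℚᵘ q
fromℚᵘ-homo-* p q = toℚᵘ-injective (ℚᵘ.≃-trans (toℚᵘ-fromℚᵘ (p ℚᵘ.* q))
  (ℚᵘ.≃-trans (ℚᵘ.*-cong (ℚᵘ.≃-sym (toℚᵘ-fromℚᵘ p)) (ℚᵘ.≃-sym (toℚᵘ-fromℚᵘ q)))
    (ℚᵘ.≃-sym (toℚᵘ-homo-* (fromℚᵘ p) (fromℚᵘ q)))))

-- ι m and inv (suc m) are definitionally fromℚᵘ (mkℚᵘ (+ m) 0) and fromℚᵘ (mkℚᵘ (+ 1) m).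
ι-homo-+ : ∀ m n → ι (m ℕ.+ n) ≡ ι m + ι n
ι-homo-+ m n = trans
  (fromℚᵘ-cong {mkℚᵘ (+ (m ℕ.+ n)) 0} {mkℚᵘ (+ m) 0 ℚᵘ.+ mkℚᵘ (+ n) 0}
    (*≡* (cong (ℤ._* + 1) +[m+n]≡m*1+n*1)))
  (fromℚᵘ-homo-+ (mkℚᵘ (+ m) 0) (mkℚᵘ (+ n) 0))
  where
  +[m+n]≡m*1+n*1 : + (m ℕ.+ n) ≡ + m ℤ.* + 1 ℤ.+ + n ℤ.* + 1
  +[m+n]≡m*1+n*1 = trans (ℤ.pos-+ m n)
    (sym (cong₂ ℤ._+_ (ℤ.*-identityʳ (+ m)) (ℤ.*-identityʳ (+ n))))

ι-homo-* : ∀ m n → ι (m *ℕ n) ≡ ι m * ι n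
ι-homo-* m n = trans
  (fromℚᵘ-cong {mkℚᵘ (+ (m *ℕ n)) 0} {mkℚᵘ (+ m) 0 ℚᵘ.* mkℚᵘ (+ n) 0}
    (*≡* (cong (ℤ._* + 1) (ℤ.pos-* m n))))
  (fromℚᵘ-homo-* (mkℚᵘ (+ m) 0) (mkℚᵘ (+ n) 0))

ι*inv≡1 : ∀ m .{{_ : NonZero m}} → ι m * inv m ≡ 1ℚ
ι*inv≡1 (suc m) = trans (sym (fromℚᵘ-homo-* (mkℚᵘ (+ suc m) 0) (mkℚᵘ (+ 1) m)))
                        (fromℚᵘ-cong (ℚᵘ.*-inverseʳ (mkℚᵘ (+ suc m) 0)))

inv-unique : ∀ m .{{_ : NonZero m}} q → ι m * q ≡ 1ℚ → inv m ≡ q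
inv-unique m q ιm*q≡1 = begin
  inv m               ≡⟨ sym (*-identityʳ (inv m)) ⟩
  inv m * 1ℚ          ≡⟨ cong (inv m *_) (sym ιm*q≡1) ⟩
  inv m * (ι m * q)   ≡⟨ solve 3 (λ u M v → u :* (M :* v) := (M :* u) :* v) refl (inv m) (ι m) q ⟩
  ι m * inv m * q     ≡⟨ cong (_* q) (ι*inv≡1 m) ⟩
  1ℚ * q              ≡⟨ *-identityˡ q ⟩
  q                   ∎

ι[m*n]*inv-m*inv-n≡1 : ∀ m n .{{_ : NonZero m}} .{{_ : NonZero n}} → ι (m *ℕ n) * (inv m * inv n) ≡ 1ℚ
ι[m*n]*inv-m*inv-n≡1 m n = begin
  ι (m *ℕ n) * (inv m * inv n)   ≡⟨ cong (_* (inv m * inv n)) (ι-homo-* m n) ⟩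
  ι m * ι n * (inv m * inv n)
    ≡⟨ solve 4 (λ M N x y → M :* N :* (x :* y) := (M :* x) :* (N :* y)) refl (ι m) (ι n) (inv m) (inv n) ⟩
  (ι m * inv m) * (ι n * inv n)  ≡⟨ cong₂ _*_ (ι*inv≡1 m) (ι*inv≡1 n) ⟩
  1ℚ * 1ℚ                        ≡⟨ *-identityˡ 1ℚ ⟩
  1ℚ                             ∎

inv-* : ∀ m n → inv (m *ℕ n) ≡ inv m * inv n
inv-* zero      n         = sym (*-zeroˡ (inv n))
inv-* (suc m)   zero      = trans (cong inv (ℕ.*-zeroʳ (suc m))) (sym (*-zeroʳ (inv (suc m))))
inv-* m@(suc _) n@(suc _) = inv-unique (m *ℕ n) (inv m * inv n) (ι[m*n]*inv-m*inv-n≡1 m n)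

inv-+ : ∀ p q r .{{_ : NonZero p}} .{{_ : NonZero q}} .{{_ : NonZero r}} →
        p *ℕ (q ℕ.+ r) ≡ q *ℕ r → inv p ≡ inv q + inv r
inv-+ p q r p[q+r]≡qr = inv-unique p (inv q + inv r) (begin
  ι p * (inv q + inv r)
    ≡⟨ cong (ι p *_) (sym (cong₂ _+_ (ι*inv-cancelˡ r q) (ι*inv-cancelˡ q r))) ⟩
  ι p * ((ι r * inv r) * inv q + (ι q * inv q) * inv r)
    ≡⟨ solve 5 (λ P Q x R y → P :* ((R :* y) :* x :+ (Q :* x) :* y) := P :* (Q :+ R) :* (x :* y))
         refl (ι p) (ι q) (inv q) (ι r) (inv r) ⟩
  ι p * (ι q + ι r) * (inv q * inv r)
    ≡⟨ cong (_* (inv q * inv r)) (sym (trans (ι-homo-* p (q ℕ.+ r)) (cong (ι p *_) (ι-homo-+ q r)))) ⟩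
  ι (p *ℕ (q ℕ.+ r)) * (inv q * inv r)
    ≡⟨ cong (λ n → ι n * (inv q * inv r)) p[q+r]≡qr ⟩
  ι (q *ℕ r) * (inv q * inv r)
    ≡⟨ ι[m*n]*inv-m*inv-n≡1 q r ⟩
  1ℚ ∎)
  where
  ι*inv-cancelˡ : ∀ m n .{{_ : NonZero m}} → ι m * inv m * inv n ≡ inv n
  ι*inv-cancelˡ m n = trans (cong (_* inv n) (ι*inv≡1 m)) (*-identityˡ (inv n))

alternating-sum-by-parts : (x a b c : ℕ → ℚ) (m : ℕ) →
  (∀ j → j < m → a (suc j) ≡ c j + c (suc j)) →
  (∀ j → b (suc j) ≡ x (suc j) * c j) →
  Σ₁ m (λ k → sgn k * Σ₁ k x * a k) ≡ Σ₁ m (λ k → sgn k * b k) + sgn m * Σ₁ m x * c m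
alternating-sum-by-parts x a b c zero    _  _  = sym (trans (+-identityˡ (0ℚ * c 0)) (*-zeroˡ (c 0)))
alternating-sum-by-parts x a b c (suc m) a≡ b≡ = begin
  Σ₁ m (λ k → sgn k * Σ₁ k x * a k) + - s * (h + xₘ₊₁) * a (suc m)
    ≡⟨ cong₂ (λ S t → S + - s * (h + xₘ₊₁) * t)
         (alternating-sum-by-parts x a b c m (λ j j<m → a≡ j (ℕ.m<n⇒m<1+n j<m)) b≡)
         (a≡ m (ℕ.n<1+n m)) ⟩
  (B + s * h * c m) + - s * (h + xₘ₊₁) * (c m + c (suc m))
    ≡⟨ solve 6 (λ B s h x c₀ c₁ → (B :+ s :* h :* c₀) :+ (:- s) :* (h :+ x) :* (c₀ :+ c₁)
                                := (B :+ (:- s) :* (x :* c₀)) :+ (:- s) :* (h :+ x) :* c₁)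
         refl B s h xₘ₊₁ (c m) (c (suc m)) ⟩
  (B + - s * (xₘ₊₁ * c m)) + - s * (h + xₘ₊₁) * c (suc m)
    ≡⟨ cong (λ t → (B + - s * t) + - s * (h + xₘ₊₁) * c (suc m)) (sym (b≡ m)) ⟩
  (B + - s * b (suc m)) + - s * (h + xₘ₊₁) * c (suc m) ∎
  where
  s h xₘ₊₁ B : ℚ
  s = sgn m
  h = Σ₁ m x
  xₘ₊₁ = x (suc m)
  B = Σ₁ m (λ k → sgn k * b k)

inv-[k+1]nC[k+1] : ∀ n k → k < n →
  inv (suc k *ℕ (n C suc k)) ≡ inv (suc n) * inv (n C k) + inv (suc n) * inv (n C suc k)
inv-[k+1]nC[k+1] n k k<n = begin
  inv (suc k *ℕ (n C suc k))
    ≡⟨ inv-+ (suc k *ℕ (n C suc k)) (suc n *ℕ (n C k)) (suc n *ℕ (n C suc k))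
         {{ℕ.m*n≢0 (suc k) (n C suc k)}} {{ℕ.m*n≢0 (suc n) (n C k)}} {{ℕ.m*n≢0 (suc n) (n C suc k)}}
         ([k+1]nC[k+1]*[[n+1]nCk+[n+1]nC[k+1]]≡[n+1]nCk*[n+1]nC[k+1] n k) ⟩
  inv (suc n *ℕ (n C k)) + inv (suc n *ℕ (n C suc k))
    ≡⟨ cong₂ _+_ (inv-* (suc n) (n C k)) (inv-* (suc n) (n C suc k)) ⟩
  inv (suc n) * inv (n C k) + inv (suc n) * inv (n C suc k) ∎
  where
  instance
    nCk≢0ᵢ : NonZero (n C k)
    nCk≢0ᵢ = nCk≢0 (ℕ.<⇒≤ k<n)
    nC[k+1]≢0ᵢ : NonZero (n C suc k)
    nC[k+1]≢0ᵢ = nCk≢0 k<n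

inv-[k+1]²[n+1]C[k+1] : ∀ n k →
  inv (suc k *ℕ suc k *ℕ (suc n C suc k)) ≡ inv (suc k) * (inv (suc n) * inv (n C k))
inv-[k+1]²[n+1]C[k+1] n k = begin
  inv (suc k *ℕ suc k *ℕ (suc n C suc k))    ≡⟨ cong inv (ℕ.*-assoc (suc k) (suc k) (suc n C suc k)) ⟩
  inv (suc k *ℕ (suc k *ℕ (suc n C suc k)))  ≡⟨ inv-* (suc k) (suc k *ℕ (suc n C suc k)) ⟩
  inv (suc k) * inv (suc k *ℕ (suc n C suc k))
    ≡⟨ cong (λ m → inv (suc k) * inv m) ([k+1]*[n+1]C[k+1]≡[n+1]*nCk n k) ⟩
  inv (suc k) * inv (suc n *ℕ (n C k))       ≡⟨ cong (inv (suc k) *_) (inv-* (suc n) (n C k)) ⟩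
  inv (suc k) * (inv (suc n) * inv (n C k))  ∎

mainTheorem18 : (n : ℕ) →
    Σ₁ n (λ k → sgn k * H k * inv (k *ℕ (n C k)))
      ≡ sgn n * H (suc n) * inv (suc n)
        + Σ₁ (suc n) (λ k → sgn k * inv (k *ℕ k *ℕ (suc n C k)))
mainTheorem18 n = begin
  Σ₁ n (λ k → sgn k * H k * inv (k *ℕ (n C k)))
    ≡⟨ alternating-sum-by-parts inv (λ k → inv (k *ℕ (n C k))) b c n
         (inv-[k+1]nC[k+1] n) (inv-[k+1]²[n+1]C[k+1] n) ⟩
  B + sgn n * H n * c n                       ≡⟨ cong (λ t → B + sgn n * H n * t) cₙ≡w ⟩
  B + sgn n * H n * w
    -- H (suc n) is definitionally H n + w
    ≡⟨ solve 4 (λ B s h w → B :+ s :* h :* w := s :* (h :+ w) :* w :+ (B :+ (:- s) :* (w :* w)))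
         refl B (sgn n) (H n) w ⟩
  sgn n * H (suc n) * w + (B + - sgn n * (w * w))
    ≡⟨ cong (λ t → sgn n * H (suc n) * w + (B + - sgn n * t))
         (sym (trans (inv-[k+1]²[n+1]C[k+1] n n) (cong (w *_) cₙ≡w))) ⟩
  sgn n * H (suc n) * w + (B + - sgn n * b (suc n)) ∎
  where
  w : ℚ
  w = inv (suc n)
  b : ℕ → ℚ
  b k = inv (k *ℕ k *ℕ (suc n C k))
  c : ℕ → ℚ
  c k = w * inv (n C k)
  B : ℚ
  B = Σ₁ n (λ k → sgn k * b k)
  cₙ≡w : c n ≡ w
  cₙ≡w = trans (cong (λ m → w * inv m) (nCn≡1 n)) (*-identityʳ w)
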